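{- For all integers $m,n\geq 3$, the edge corona $C_m\diamond C_n$ of the cycles $C_m$ and $C_n$ is antimagic.
   Context: All graphs are simple, finite and undirected. For a graph $G$ with $q$ edges, an antimagic labeling is a bijection $f:E(G)\to\{1,2,\dots,q\}$ such that the vertex sums $w(u)=\sum_{e\ni u} f(e)$ (sum over the edges incident to $u$) are pairwise distinct over all vertices $u\in V(G)$. A graph is antimagic if it admits an antimagic labeling. $C_m$ denotes the cycle on $m$ vertices. For graphs $G$ and $H$, the edge corona $G\diamond H$ is obtained by taking one copy of $G$ and $|E(G)|$ vertex-disjoint copies of $H$, one copy associated to each edge of $G$, and joining both end vertices of the $i$-th edge of $G$ to every vertex of the $i$-th copy of $H$. -}

module Defs where

open import Data.Nat using (ℕ; zero; suc; _+_; _*_)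
open import Data.Nat.DivMod using (_mod_)
open import Data.Fin using (Fin; toℕ; _↑ˡ_; _↑ʳ_; splitAt; combine; remQuot; _≟_)
open import Data.Fin.Permutation using (Permutation; _⟨$⟩ʳ_)
open import Data.Product using (_×_; _,_; Σ)
open import Data.Sum using (inj₁; inj₂)
open import Data.Bool using (Bool; true; false; if_then_else_; _∨_)
open import Data.List using (List; map; allFin)
open import Data.Nat.ListAction using (sum)
open import Relation.Nullary.Decidable using (⌊_⌋)
open import Relation.Binary.PropositionalEquality using (_≡_)
open import Function.Definitions using (Injective)

record Graph : Set where
  field
    V    : ℕ
    E    : ℕ
    ends : Fin E → Fin V × Fin V
open Graph public

Cycle : ℕ → Graph
Cycle zero    = record { V = zero ; E = zero ; ends = λ () }
Cycle (suc k) = record { V = suc k ; E = suc k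
                       ; ends = λ i → i , (suc (toℕ i) mod (suc k)) }

-- Vertices: Fin (V G + E G * V H); a vertex of G is  u ↑ˡ _,
-- vertex v of the copy of H attached to edge e of G is  _ ↑ʳ combine e v.
-- Edges: Fin (E G + (E G * E H + E G * (V H * 2))):
--   edges of G, then edges of the copies of H, then the join edges
--   (edge e of G, vertex v of its copy, which endpoint b of e).
_◇_ : Graph → Graph → Graph
G ◇ H = record { V = V G + E G * V H ; E = E G + (E G * E H + E G * (V H * 2)) ; ends = es }
  where
  gv : Fin (V G) → Fin (V G + E G * V H)
  gv u = u ↑ˡ (E G * V H)
  hv : Fin (E G) → Fin (V H) → Fin (V G + E G * V H)
  hv e v = V G ↑ʳ combine e v
  pick : Fin 2 → Fin (V G) × Fin (V G) → Fin (V G)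
  pick Fin.zero (a , b) = a
  pick (Fin.suc _) (a , b) = b
  es : Fin (E G + (E G * E H + E G * (V H * 2))) → Fin (V G + E G * V H) × Fin (V G + E G * V H)
  es k with splitAt (E G) k
  ... | inj₁ e with ends G e
  ...   | (a , b) = gv a , gv b
  es k | inj₂ k' with splitAt (E G * E H) k'
  ... | inj₁ x with remQuot (E H) x
  ...   | (e , f) with ends H f
  ...     | (a , b) = hv e a , hv e b
  es k | inj₂ k' | inj₂ y with remQuot (V H * 2) y
  ... | (e , z) with remQuot 2 z
  ...   | (v , s) = gv (pick s (ends G e)) , hv e v

incident : (G : Graph) → Fin (V G) → Fin (E G) → Bool
incident G u i with ends G i
... | (a , b) = ⌊ u ≟ a ⌋ ∨ ⌊ u ≟ b ⌋

-- A labeling is a bijection from the edges onto {1,…,q}; we encode it as a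
-- permutation σ of Fin q, the label of edge i being 1 + toℕ (σ i).
label : {q : ℕ} → Permutation q q → Fin q → ℕ
label σ i = suc (toℕ (σ ⟨$⟩ʳ i))

weight : (G : Graph) → Permutation (E G) (E G) → Fin (V G) → ℕ
weight G σ u = sum (map (λ i → if incident G u i then label σ i else 0) (allFin (E G)))

IsAntimagicLabeling : (G : Graph) → Permutation (E G) (E G) → Set
IsAntimagicLabeling G σ = Injective _≡_ _≡_ (weight G σ)

Antimagic : Graph → Set
Antimagic G = Σ (Permutation (E G) (E G)) (IsAntimagicLabeling G)

module Submission where

-- Label the edges of C_m by 1, …, m.  Give the e-th copy of C_n the e-th block of 2n consecutive
-- labels above m, shared between its edges and its join edges to the second end of e, and give
-- the join edges to the first ends the top mn labels, in reverse order.  A vertex v of the e-th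
-- copy then has weight K + r v + 5n·e with r injective and r v < 5n, so the copy vertices get
-- distinct weights.  A vertex u of C_m meets the n join edges of each of two copies, all labelled
-- above m, so its weight is of order m n² and exceeds every copy weight; among these vertices the
-- weight is an increasing affine function of u for u ≠ 0, and it is largest at u = 0.

open import Data.Bool using (Bool; true; false; if_then_else_; _∧_)
open import Data.Bool.Properties using (∨-identityʳ)
open import Data.Fin using (Fin; toℕ; fromℕ; inject₁; opposite; _↑ˡ_; _↑ʳ_; combine; quotRem; _≟_)
open import Data.Fin.Patterns using (0F; 1F)
open import Data.Fin.Permutation using (Permutation; cast-id)
open import Data.Fin.Properties
  using ( suc-injective; toℕ-injective; toℕ<n; toℕ-fromℕ; toℕ-fromℕ<; toℕ-inject₁; toℕ-cast
        ; toℕ-↑ˡ; toℕ-↑ʳ; toℕ-combine; opposite-prop; opposite-involutive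
        ; splitAt-↑ˡ; splitAt-↑ʳ; remQuot-combine; +↔⊎; *↔× )
open import Data.List using (tabulate)
open import Data.List.Properties using (map-tabulate)
open import Data.Nat using (ℕ; zero; suc; _+_; _*_; _<_; _≤_; z≤n; s≤s; s≤s⁻¹; NonZero)
import Data.Nat.Properties as ℕ
open import Algebra.Properties.CommutativeSemigroup ℕ.+-commutativeSemigroup using (interchange)
open import Data.Nat.DivMod using (_%_; [m+kn]%n≡m%n; m<n⇒m%n≡m; n%n≡0)
open import Data.Nat.ListAction using (sum)
open import Data.Nat.Tactic.RingSolver using (solve-∀)
open import Data.Product using (_×_; _,_; proj₁; proj₂; swap)
open import Data.Product.Function.NonDependent.Propositional using (_×-↔_)
open import Data.Product.Properties using (,-injective)
open import Data.Sum using (_⊎_; inj₁; inj₂)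
open import Data.Sum.Function.Propositional using (_⊎-↔_)
open import Data.Sum.Properties using (inj₁-injective; inj₂-injective)
open import Function using (_∘_; case_of_)
open import Function.Bundles using (_↔_; _⇔_; Inverse; mk↔ₛ′; mk⇔)
open import Function.Construct.Identity using (↔-id)
open import Function.Definitions using (Injective)
open import Function.Properties.Inverse using (↔-trans; ↔-sym)
open import Relation.Binary.PropositionalEquality
open import Relation.Nullary using (Dec; yes; no)
open import Relation.Nullary.Decidable using (⌊_⌋; ⌊⌋-map′; isYes≗does; does-⇔; dec-false; _×-dec_)
open import Relation.Nullary.Negation using (¬_; contradiction)

open import Defs

∑ : (n : ℕ) → (Fin n → ℕ) → ℕ
∑ n f = sum (tabulate f)

∑-cong : ∀ n {f g : Fin n → ℕ} → (∀ i → f i ≡ g i) → ∑ n f ≡ ∑ n g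
∑-cong zero    f≗g = refl
∑-cong (suc n) f≗g = cong₂ _+_ (f≗g 0F) (∑-cong n (f≗g ∘ Fin.suc))

∑-zero : ∀ n → ∑ n (λ _ → 0) ≡ 0
∑-zero zero    = refl
∑-zero (suc n) = ∑-zero n

∑-const : ∀ n c → ∑ n (λ _ → c) ≡ n * c
∑-const zero    c = refl
∑-const (suc n) c = cong (c +_) (∑-const n c)

∑-distrib-+ : ∀ n (f g : Fin n → ℕ) → ∑ n (λ i → f i + g i) ≡ ∑ n f + ∑ n g
∑-distrib-+ zero    f g = refl
∑-distrib-+ (suc n) f g = trans (cong (f 0F + g 0F +_) (∑-distrib-+ n (f ∘ Fin.suc) (g ∘ Fin.suc)))
                                (interchange (f 0F) (g 0F) _ _)

∑-*ˡ : ∀ n c (f : Fin n → ℕ) → ∑ n (λ i → c * f i) ≡ c * ∑ n f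
∑-*ˡ zero    c f = sym (ℕ.*-zeroʳ c)
∑-*ˡ (suc n) c f = trans (cong (c * f 0F +_) (∑-*ˡ n c (f ∘ Fin.suc))) (sym (ℕ.*-distribˡ-+ c (f 0F) _))

∑-affine : ∀ n c d (f : Fin n → ℕ) → ∑ n (λ i → c + d * f i) ≡ n * c + d * ∑ n f
∑-affine n c d f = trans (∑-distrib-+ n (λ _ → c) (λ i → d * f i)) (cong₂ _+_ (∑-const n c) (∑-*ˡ n d f))

∑-two : (f : Fin 2 → ℕ) → ∑ 2 f ≡ f 0F + f 1F
∑-two f = cong (f 0F +_) (ℕ.+-identityʳ (f 1F))

∑-↑ : ∀ a b (f : Fin (a + b) → ℕ) → ∑ (a + b) f ≡ ∑ a (f ∘ (_↑ˡ b)) + ∑ b (f ∘ (a ↑ʳ_))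
∑-↑ zero    b f = refl
∑-↑ (suc a) b f = trans (cong (f 0F +_) (∑-↑ a b (f ∘ Fin.suc))) (sym (ℕ.+-assoc (f 0F) _ _))

∑-combine : ∀ a b (f : Fin (a * b) → ℕ) → ∑ (a * b) f ≡ ∑ a (λ i → ∑ b (f ∘ combine i))
∑-combine zero    b f = refl
∑-combine (suc a) b f = trans (∑-↑ b (a * b) f) (cong (∑ b (f ∘ (_↑ˡ (a * b))) +_) (∑-combine a b (f ∘ (b ↑ʳ_))))

when : Bool → ℕ → ℕ
when b x = if b then x else 0

when-∧ : ∀ b c x → when (b ∧ c) x ≡ when b (when c x)
when-∧ true  c x = refl
when-∧ false c x = refl

∑-when : ∀ n b (f : Fin n → ℕ) → ∑ n (λ i → when b (f i)) ≡ when b (∑ n f)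
∑-when n true  f = refl
∑-when n false f = ∑-zero n

∑-δ : ∀ n (a : Fin n) (f : Fin n → ℕ) → ∑ n (λ i → when ⌊ a ≟ i ⌋ (f i)) ≡ f a
∑-δ (suc n) 0F          f = trans (cong (f 0F +_) (∑-zero n)) (ℕ.+-identityʳ (f 0F))
∑-δ (suc n) (Fin.suc a) f =
  trans (∑-cong n (λ i → cong (λ b → when b (f (Fin.suc i))) (⌊⌋-map′ (cong Fin.suc) suc-injective (a ≟ i))))
        (∑-δ n a (f ∘ Fin.suc))

∑∑-δˡ : ∀ p q (a : Fin p) (g : Fin p → Fin q → ℕ) →
        ∑ p (λ i → ∑ q (λ j → when ⌊ a ≟ i ⌋ (g i j))) ≡ ∑ q (g a)
∑∑-δˡ p q a g = trans (∑-cong p (λ i → ∑-when q ⌊ a ≟ i ⌋ (g i))) (∑-δ p a (λ i → ∑ q (g i)))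

∑∑-δ : ∀ p q (a : Fin p) (b : Fin q) (g : Fin p → Fin q → ℕ) →
       ∑ p (λ i → ∑ q (λ j → when (⌊ a ≟ i ⌋ ∧ ⌊ b ≟ j ⌋) (g i j))) ≡ g a b
∑∑-δ p q a b g = begin
  ∑ p (λ i → ∑ q (λ j → when (⌊ a ≟ i ⌋ ∧ ⌊ b ≟ j ⌋) (g i j)))
    ≡⟨ ∑-cong p (λ i → ∑-cong q (λ j → when-∧ ⌊ a ≟ i ⌋ ⌊ b ≟ j ⌋ (g i j))) ⟩
  ∑ p (λ i → ∑ q (λ j → when ⌊ a ≟ i ⌋ (when ⌊ b ≟ j ⌋ (g i j))))
    ≡⟨ ∑∑-δˡ p q a (λ i j → when ⌊ b ≟ j ⌋ (g i j)) ⟩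
  ∑ q (λ j → when ⌊ b ≟ j ⌋ (g a j))
    ≡⟨ ∑-δ q b (g a) ⟩
  g a b ∎
  where open ≡-Reasoning

⌊⌋-⇔ : ∀ {A B : Set} → A ⇔ B → (a? : Dec A) (b? : Dec B) → ⌊ a? ⌋ ≡ ⌊ b? ⌋
⌊⌋-⇔ A⇔B a? b? = trans (isYes≗does a?) (trans (does-⇔ A⇔B a? b?) (sym (isYes≗does b?)))

⌊⌋-false : ∀ {A : Set} (a? : Dec A) → ¬ A → ⌊ a? ⌋ ≡ false
⌊⌋-false a? ¬a = trans (isYes≗does a?) (dec-false a? ¬a)

⌊⌋-×-dec : ∀ {A B : Set} (a? : Dec A) (b? : Dec B) → ⌊ a? ×-dec b? ⌋ ≡ ⌊ a? ⌋ ∧ ⌊ b? ⌋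
⌊⌋-×-dec a? b? = trans (isYes≗does (a? ×-dec b?)) (sym (cong₂ _∧_ (isYes≗does a?) (isYes≗does b?)))

remQuot-unique : ∀ {c x x′ r r′} .{{_ : NonZero c}} → r < c → r′ < c →
                 r + x * c ≡ r′ + x′ * c → r ≡ r′ × x ≡ x′
remQuot-unique {c} {x} {x′} {r} {r′} r<c r′<c eq =
  r≡r′ , ℕ.*-cancelʳ-≡ x x′ c (ℕ.+-cancelˡ-≡ r _ _ (trans eq (cong (_+ x′ * c) (sym r≡r′))))
  where
  open ≡-Reasoning
  r≡r′ : r ≡ r′
  r≡r′ = begin
    r                 ≡⟨ m<n⇒m%n≡m r<c ⟨
    r % c             ≡⟨ [m+kn]%n≡m%n r x c ⟨
    (r + x * c) % c   ≡⟨ cong (_% c) eq ⟩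
    (r′ + x′ * c) % c ≡⟨ [m+kn]%n≡m%n r′ x′ c ⟩
    r′ % c            ≡⟨ m<n⇒m%n≡m r′<c ⟩
    r′                ∎

injective-via-↔ : ∀ {A B C : Set} (π : A ↔ B) {f : A → C} →
                  Injective _≡_ _≡_ (f ∘ Inverse.from π) → Injective _≡_ _≡_ f
injective-via-↔ π {f} f∘from-injective {x} {y} fx≡fy = begin
  x                 ≡⟨ Inverse.strictlyInverseʳ π x ⟨
  from (to x)       ≡⟨ cong from (f∘from-injective (begin
                         f (from (to x)) ≡⟨ cong f (Inverse.strictlyInverseʳ π x) ⟩
                         f x             ≡⟨ fx≡fy ⟩
                         f y             ≡⟨ cong f (Inverse.strictlyInverseʳ π y) ⟨
                         f (from (to y)) ∎)) ⟩
  from (to y)       ≡⟨ Inverse.strictlyInverseʳ π y ⟩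
  y                 ∎
  where
  open ≡-Reasoning
  open Inverse π using (to; from)

maximum-at-0F⇒injective : ∀ {k} (f : Fin (suc k) → ℕ) → (∀ t → f (Fin.suc t) < f 0F) →
                          Injective _≡_ _≡_ (f ∘ Fin.suc) → Injective _≡_ _≡_ f
maximum-at-0F⇒injective f max inj {0F}        {0F}         _  = refl
maximum-at-0F⇒injective f max inj {0F}        {Fin.suc t′} eq = contradiction (sym eq) (ℕ.<⇒≢ (max t′))
maximum-at-0F⇒injective f max inj {Fin.suc t} {0F}         eq = contradiction eq (ℕ.<⇒≢ (max t))
maximum-at-0F⇒injective f max inj {Fin.suc t} {Fin.suc t′} eq = cong Fin.suc (inj eq)

quotRem-combine : ∀ {n k} (i : Fin n) (j : Fin k) → quotRem k (combine i j) ≡ (j , i)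
quotRem-combine {n} {k} i j = cong swap (remQuot-combine {n} {k} i j)

toℕ+toℕ-opposite : ∀ {k} (i : Fin (suc k)) → toℕ i + toℕ (opposite i) ≡ k
toℕ+toℕ-opposite i = trans (cong (toℕ i +_) (opposite-prop i)) (ℕ.m+[n∸m]≡n (s≤s⁻¹ (toℕ<n i)))

incidenceSum : (G : Graph) → (Fin (E G) → ℕ) → Fin (V G) → ℕ
incidenceSum G ℓ u = ∑ (E G) (λ i → when (incident G u i) (ℓ i))

weight≡incidenceSum : ∀ G σ u → weight G σ u ≡ incidenceSum G (label σ) u
weight≡incidenceSum G σ u = cong sum (map-tabulate (λ i → i) (λ i → when (incident G u i) (label σ i)))

module Corona (G H : Graph) where

  open ≡-Reasoning

  Γ : Graph
  Γ = G ◇ H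

  Edge : Set
  Edge = Fin (E G) ⊎ (Fin (E G) × Fin (E H) ⊎ Fin (E G) × (Fin (V H) × Fin 2))

  -- Both layouts agree definitionally with the indexing used by _◇_.
  edgeLayout : Fin (E Γ) ↔ Edge
  edgeLayout = ↔-trans +↔⊎ (↔-id _ ⊎-↔ ↔-trans +↔⊎ (*↔× ⊎-↔ ↔-trans *↔× (↔-id _ ×-↔ *↔×)))

  vertexLayout : Fin (V Γ) ↔ (Fin (V G) ⊎ Fin (E G) × Fin (V H))
  vertexLayout = ↔-trans +↔⊎ (↔-id _ ⊎-↔ *↔×)

  edgeAt : Edge → Fin (E Γ)
  edgeAt = Inverse.from edgeLayout

  vertexAt : Fin (V G) ⊎ Fin (E G) × Fin (V H) → Fin (V Γ)
  vertexAt = Inverse.from vertexLayout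

  baseEdge : Fin (E G) → Fin (E Γ)
  baseEdge e = edgeAt (inj₁ e)

  copyEdge : Fin (E G) → Fin (E H) → Fin (E Γ)
  copyEdge e f = edgeAt (inj₂ (inj₁ (e , f)))

  joinEdge : Fin (E G) → Fin (V H) → Fin 2 → Fin (E Γ)
  joinEdge e v s = edgeAt (inj₂ (inj₂ (e , v , s)))

  base : Fin (V G) → Fin (V Γ)
  base u = vertexAt (inj₁ u)

  copy : Fin (E G) → Fin (V H) → Fin (V Γ)
  copy e v = vertexAt (inj₂ (e , v))

  ∑-edges : (F : Fin (E Γ) → ℕ) →
            ∑ (E Γ) F ≡ ∑ (E G) (F ∘ baseEdge)
                      + (∑ (E G) (λ e → ∑ (E H) (F ∘ copyEdge e))
                      + ∑ (E G) (λ e → ∑ (V H) (λ v → ∑ 2 (F ∘ joinEdge e v))))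
  ∑-edges F
    rewrite ∑-↑ (E G) (E G * E H + E G * (V H * 2)) F
          | ∑-↑ (E G * E H) (E G * (V H * 2)) (F ∘ (E G ↑ʳ_))
          | ∑-combine (E G) (E H) (F ∘ (E G ↑ʳ_) ∘ (_↑ˡ E G * (V H * 2)))
          | ∑-combine (E G) (V H * 2) (F ∘ (E G ↑ʳ_) ∘ ((E G * E H) ↑ʳ_))
    = cong (λ z → ∑ (E G) (F ∘ baseEdge) + (∑ (E G) (λ e → ∑ (E H) (F ∘ copyEdge e)) + z))
           (∑-cong (E G) (λ e → ∑-combine (V H) 2 (F ∘ (E G ↑ʳ_) ∘ ((E G * E H) ↑ʳ_) ∘ combine e)))

  vertexAt-injective : ∀ {x y} → vertexAt x ≡ vertexAt y → x ≡ y
  vertexAt-injective {x} {y} eq = begin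
    x                                  ≡⟨ Inverse.strictlyInverseˡ vertexLayout x ⟨
    Inverse.to vertexLayout (vertexAt x) ≡⟨ cong (Inverse.to vertexLayout) eq ⟩
    Inverse.to vertexLayout (vertexAt y) ≡⟨ Inverse.strictlyInverseˡ vertexLayout y ⟩
    y                                  ∎

  base≟base : ∀ u u′ → ⌊ base u ≟ base u′ ⌋ ≡ ⌊ u ≟ u′ ⌋
  base≟base u u′ = ⌊⌋-⇔ (mk⇔ (inj₁-injective ∘ vertexAt-injective {inj₁ u} {inj₁ u′}) (cong base))
                         (base u ≟ base u′) (u ≟ u′)

  base≟copy : ∀ u e v → ⌊ base u ≟ copy e v ⌋ ≡ false
  base≟copy u e v = ⌊⌋-false (base u ≟ copy e v) (λ eq → case vertexAt-injective {inj₁ u} {inj₂ (e , v)} eq of λ ())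

  copy≟base : ∀ e v u → ⌊ copy e v ≟ base u ⌋ ≡ false
  copy≟base e v u = ⌊⌋-false (copy e v ≟ base u) (λ eq → case vertexAt-injective {inj₂ (e , v)} {inj₁ u} eq of λ ())

  copy≟copy : ∀ e v e′ v′ → ⌊ copy e v ≟ copy e′ v′ ⌋ ≡ ⌊ e ≟ e′ ⌋ ∧ ⌊ v ≟ v′ ⌋
  copy≟copy e v e′ v′ =
    trans (⌊⌋-⇔ (mk⇔ (,-injective ∘ inj₂-injective ∘ vertexAt-injective {inj₂ (e , v)} {inj₂ (e′ , v′)})
                     (λ (p , q) → cong₂ copy p q))
                (copy e v ≟ copy e′ v′) (e ≟ e′ ×-dec v ≟ v′))
          (⌊⌋-×-dec (e ≟ e′) (v ≟ v′))

  private
    R : ℕ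
    R = E G * E H + E G * (V H * 2)

  ends-baseEdge : ∀ e → ends Γ (baseEdge e) ≡ (base (proj₁ (ends G e)) , base (proj₂ (ends G e)))
  ends-baseEdge e rewrite splitAt-↑ˡ (E G) e R = refl

  ends-copyEdge : ∀ e f → ends Γ (copyEdge e f) ≡ (copy e (proj₁ (ends H f)) , copy e (proj₂ (ends H f)))
  ends-copyEdge e f rewrite splitAt-↑ʳ (E G) R (combine e f ↑ˡ (E G * (V H * 2)))
                          | splitAt-↑ˡ (E G * E H) (combine e f) (E G * (V H * 2))
                          | quotRem-combine {E G} {E H} e f = refl

  ends-joinEdge₀ : ∀ e v → ends Γ (joinEdge e v 0F) ≡ (base (proj₁ (ends G e)) , copy e v)
  ends-joinEdge₀ e v rewrite splitAt-↑ʳ (E G) R ((E G * E H) ↑ʳ combine e (combine v 0F))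
                           | splitAt-↑ʳ (E G * E H) (E G * (V H * 2)) (combine e (combine v 0F))
                           | quotRem-combine {E G} {V H * 2} e (combine v 0F)
                           | quotRem-combine {V H} {2} v 0F = refl

  ends-joinEdge₁ : ∀ e v → ends Γ (joinEdge e v 1F) ≡ (base (proj₂ (ends G e)) , copy e v)
  ends-joinEdge₁ e v rewrite splitAt-↑ʳ (E G) R ((E G * E H) ↑ʳ combine e (combine v 1F))
                           | splitAt-↑ʳ (E G * E H) (E G * (V H * 2)) (combine e (combine v 1F))
                           | quotRem-combine {E G} {V H * 2} e (combine v 1F)
                           | quotRem-combine {V H} {2} v 1F = refl

  incident-base-baseEdge : ∀ u e → incident Γ (base u) (baseEdge e) ≡ incident G u e
  incident-base-baseEdge u e
    rewrite ends-baseEdge e | base≟base u (proj₁ (ends G e)) | base≟base u (proj₂ (ends G e)) = refl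

  incident-base-copyEdge : ∀ u e f → incident Γ (base u) (copyEdge e f) ≡ false
  incident-base-copyEdge u e f
    rewrite ends-copyEdge e f | base≟copy u e (proj₁ (ends H f)) | base≟copy u e (proj₂ (ends H f)) = refl

  incident-base-joinEdge₀ : ∀ u e v → incident Γ (base u) (joinEdge e v 0F) ≡ ⌊ u ≟ proj₁ (ends G e) ⌋
  incident-base-joinEdge₀ u e v
    rewrite ends-joinEdge₀ e v | base≟base u (proj₁ (ends G e)) | base≟copy u e v = ∨-identityʳ _

  incident-base-joinEdge₁ : ∀ u e v → incident Γ (base u) (joinEdge e v 1F) ≡ ⌊ u ≟ proj₂ (ends G e) ⌋
  incident-base-joinEdge₁ u e v
    rewrite ends-joinEdge₁ e v | base≟base u (proj₂ (ends G e)) | base≟copy u e v = ∨-identityʳ _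

  incident-copy-baseEdge : ∀ e v e′ → incident Γ (copy e v) (baseEdge e′) ≡ false
  incident-copy-baseEdge e v e′
    rewrite ends-baseEdge e′ | copy≟base e v (proj₁ (ends G e′)) | copy≟base e v (proj₂ (ends G e′)) = refl

  incident-copy-copyEdge : ∀ e v e′ f → incident Γ (copy e v) (copyEdge e′ f) ≡ ⌊ e ≟ e′ ⌋ ∧ incident H v f
  incident-copy-copyEdge e v e′ f
    rewrite ends-copyEdge e′ f | copy≟copy e v e′ (proj₁ (ends H f)) | copy≟copy e v e′ (proj₂ (ends H f))
    with ⌊ e ≟ e′ ⌋
  ... | true  = refl
  ... | false = refl

  incident-copy-joinEdge : ∀ e v e′ v′ s →
                           incident Γ (copy e v) (joinEdge e′ v′ s) ≡ ⌊ e ≟ e′ ⌋ ∧ ⌊ v ≟ v′ ⌋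
  incident-copy-joinEdge e v e′ v′ 0F
    rewrite ends-joinEdge₀ e′ v′ | copy≟base e v (proj₁ (ends G e′)) | copy≟copy e v e′ v′ = refl
  incident-copy-joinEdge e v e′ v′ 1F
    rewrite ends-joinEdge₁ e′ v′ | copy≟base e v (proj₂ (ends G e′)) | copy≟copy e v e′ v′ = refl

  module _ (ℓ : Fin (E Γ) → ℕ) where

    private
      incidentLabel : Fin (V Γ) → Fin (E Γ) → ℕ
      incidentLabel x k = when (incident Γ x k) (ℓ k)

      byIncidence : ∀ x k {b} → incident Γ x k ≡ b → incidentLabel x k ≡ when b (ℓ k)
      byIncidence x k = cong (λ b → when b (ℓ k))

    incidenceSum-copy : ∀ e v → incidenceSum Γ ℓ (copy e v)
                              ≡ incidenceSum H (ℓ ∘ copyEdge e) v + (ℓ (joinEdge e v 0F) + ℓ (joinEdge e v 1F))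
    incidenceSum-copy e v = trans (∑-edges (incidentLabel (copy e v)))
                                  (cong₂ _+_ baseEdges (cong₂ _+_ copyEdges joinEdges))
      where
      baseEdges : ∑ (E G) (incidentLabel (copy e v) ∘ baseEdge) ≡ 0
      baseEdges = trans (∑-cong (E G) λ e′ → byIncidence (copy e v) (baseEdge e′) (incident-copy-baseEdge e v e′))
                        (∑-zero (E G))

      copyEdges : ∑ (E G) (λ e′ → ∑ (E H) (incidentLabel (copy e v) ∘ copyEdge e′))
                ≡ incidenceSum H (ℓ ∘ copyEdge e) v
      copyEdges = trans (∑-cong (E G) λ e′ → ∑-cong (E H) λ f →
                           trans (byIncidence (copy e v) (copyEdge e′ f) (incident-copy-copyEdge e v e′ f))
                                 (when-∧ ⌊ e ≟ e′ ⌋ (incident H v f) (ℓ (copyEdge e′ f))))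
                        (∑∑-δˡ (E G) (E H) e (λ e′ f → when (incident H v f) (ℓ (copyEdge e′ f))))

      joinEdges : ∑ (E G) (λ e′ → ∑ (V H) (λ v′ → ∑ 2 (incidentLabel (copy e v) ∘ joinEdge e′ v′)))
                ≡ ℓ (joinEdge e v 0F) + ℓ (joinEdge e v 1F)
      joinEdges = begin
        ∑ (E G) (λ e′ → ∑ (V H) (λ v′ → ∑ 2 (incidentLabel (copy e v) ∘ joinEdge e′ v′)))
          ≡⟨ ∑-cong (E G) (λ e′ → ∑-cong (V H) λ v′ →
               trans (∑-cong 2 (λ s → byIncidence (copy e v) (joinEdge e′ v′ s) (incident-copy-joinEdge e v e′ v′ s)))
                     (∑-when 2 (⌊ e ≟ e′ ⌋ ∧ ⌊ v ≟ v′ ⌋) (ℓ ∘ joinEdge e′ v′))) ⟩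
        ∑ (E G) (λ e′ → ∑ (V H) (λ v′ → when (⌊ e ≟ e′ ⌋ ∧ ⌊ v ≟ v′ ⌋) (∑ 2 (ℓ ∘ joinEdge e′ v′))))
          ≡⟨ ∑∑-δ (E G) (V H) e v (λ e′ v′ → ∑ 2 (ℓ ∘ joinEdge e′ v′)) ⟩
        ∑ 2 (ℓ ∘ joinEdge e v)
          ≡⟨ ∑-two (ℓ ∘ joinEdge e v) ⟩
        ℓ (joinEdge e v 0F) + ℓ (joinEdge e v 1F)
          ∎

    incidenceSum-base : ∀ u → incidenceSum Γ ℓ (base u)
                            ≡ incidenceSum G (ℓ ∘ baseEdge) u
                              + ∑ (E G) (λ e → when ⌊ u ≟ proj₁ (ends G e) ⌋ (∑ (V H) (λ v → ℓ (joinEdge e v 0F)))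
                                             + when ⌊ u ≟ proj₂ (ends G e) ⌋ (∑ (V H) (λ v → ℓ (joinEdge e v 1F))))
    incidenceSum-base u = trans (∑-edges (incidentLabel (base u)))
                                (cong₂ _+_ baseEdges (trans (cong (_+ joinSum) copyEdges) joinEdges))
      where
      baseEdges : ∑ (E G) (incidentLabel (base u) ∘ baseEdge) ≡ incidenceSum G (ℓ ∘ baseEdge) u
      baseEdges = ∑-cong (E G) (λ e → byIncidence (base u) (baseEdge e) (incident-base-baseEdge u e))

      copyEdges : ∑ (E G) (λ e → ∑ (E H) (incidentLabel (base u) ∘ copyEdge e)) ≡ 0
      copyEdges = trans (∑-cong (E G) λ e →
                           trans (∑-cong (E H) λ f → byIncidence (base u) (copyEdge e f) (incident-base-copyEdge u e f))
                                 (∑-zero (E H)))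
                        (∑-zero (E G))

      joinSum : ℕ
      joinSum = ∑ (E G) (λ e → ∑ (V H) (λ v → ∑ 2 (incidentLabel (base u) ∘ joinEdge e v)))

      joinEdges : 0 + joinSum
                ≡ ∑ (E G) (λ e → when ⌊ u ≟ proj₁ (ends G e) ⌋ (∑ (V H) (λ v → ℓ (joinEdge e v 0F)))
                               + when ⌊ u ≟ proj₂ (ends G e) ⌋ (∑ (V H) (λ v → ℓ (joinEdge e v 1F))))
      joinEdges = ∑-cong (E G) λ e → begin
        ∑ (V H) (λ v → ∑ 2 (incidentLabel (base u) ∘ joinEdge e v))
          ≡⟨ ∑-cong (V H) (λ v → trans (∑-two (incidentLabel (base u) ∘ joinEdge e v))
               (cong₂ _+_ (byIncidence (base u) (joinEdge e v 0F) (incident-base-joinEdge₀ u e v))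
                          (byIncidence (base u) (joinEdge e v 1F) (incident-base-joinEdge₁ u e v)))) ⟩
        ∑ (V H) (λ v → when ⌊ u ≟ proj₁ (ends G e) ⌋ (ℓ (joinEdge e v 0F))
                     + when ⌊ u ≟ proj₂ (ends G e) ⌋ (ℓ (joinEdge e v 1F)))
          ≡⟨ ∑-distrib-+ (V H) _ _ ⟩
        ∑ (V H) (λ v → when ⌊ u ≟ proj₁ (ends G e) ⌋ (ℓ (joinEdge e v 0F)))
          + ∑ (V H) (λ v → when ⌊ u ≟ proj₂ (ends G e) ⌋ (ℓ (joinEdge e v 1F)))
          ≡⟨ cong₂ _+_ (∑-when (V H) _ (λ v → ℓ (joinEdge e v 0F)))
                       (∑-when (V H) _ (λ v → ℓ (joinEdge e v 1F))) ⟩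
        when ⌊ u ≟ proj₁ (ends G e) ⌋ (∑ (V H) (λ v → ℓ (joinEdge e v 0F)))
          + when ⌊ u ≟ proj₂ (ends G e) ⌋ (∑ (V H) (λ v → ℓ (joinEdge e v 1F)))
          ∎

module CycleFacts (k : ℕ) where

  open ≡-Reasoning

  C : Graph
  C = Cycle (suc k)

  next : Fin (suc k) → Fin (suc k)
  next e = proj₂ (ends C e)

  prev : Fin (suc k) → Fin (suc k)
  prev 0F          = fromℕ k
  prev (Fin.suc i) = inject₁ i

  toℕ-next : ∀ e → toℕ (next e) ≡ suc (toℕ e) % suc k
  toℕ-next e = toℕ-fromℕ< _

  next-prev : ∀ u → next (prev u) ≡ u
  next-prev 0F = toℕ-injective (begin
    toℕ (next (fromℕ k))        ≡⟨ toℕ-next (fromℕ k) ⟩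
    suc (toℕ (fromℕ k)) % suc k ≡⟨ cong (λ z → suc z % suc k) (toℕ-fromℕ k) ⟩
    suc k % suc k               ≡⟨ n%n≡0 (suc k) ⟩
    0                           ∎)
  next-prev (Fin.suc i) = toℕ-injective (begin
    toℕ (next (inject₁ i))        ≡⟨ toℕ-next (inject₁ i) ⟩
    suc (toℕ (inject₁ i)) % suc k ≡⟨ cong (λ z → suc z % suc k) (toℕ-inject₁ i) ⟩
    suc (toℕ i) % suc k           ≡⟨ m<n⇒m%n≡m (s≤s (toℕ<n i)) ⟩
    suc (toℕ i)                   ∎)

  toℕ-prev-zero : ∀ x → toℕ x ≡ 0 → toℕ (prev x) ≡ k
  toℕ-prev-zero 0F _ = toℕ-fromℕ k

  toℕ-prev-suc : ∀ x t → toℕ x ≡ suc t → toℕ (prev x) ≡ t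
  toℕ-prev-suc (Fin.suc i) t eq = trans (toℕ-inject₁ i) (ℕ.suc-injective eq)

  prev-next : ∀ e → prev (next e) ≡ e
  prev-next e with ℕ.m≤n⇒m<n∨m≡n (s≤s⁻¹ (toℕ<n e))
  ... | inj₁ e<k = toℕ-injective (toℕ-prev-suc (next e) (toℕ e) (trans (toℕ-next e) (m<n⇒m%n≡m (s≤s e<k))))
  ... | inj₂ e≡k = toℕ-injective (begin
    toℕ (prev (next e)) ≡⟨ toℕ-prev-zero (next e) (begin
                             toℕ (next e)        ≡⟨ toℕ-next e ⟩
                             suc (toℕ e) % suc k ≡⟨ cong (λ z → suc z % suc k) e≡k ⟩
                             suc k % suc k       ≡⟨ n%n≡0 (suc k) ⟩
                             0                   ∎) ⟩
    k                   ≡⟨ e≡k ⟨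
    toℕ e               ∎)

  ≟next : ∀ u e → ⌊ u ≟ next e ⌋ ≡ ⌊ prev u ≟ e ⌋
  ≟next u e = ⌊⌋-⇔ (mk⇔ (λ eq → trans (cong prev eq) (prev-next e))
                        (λ eq → trans (sym (next-prev u)) (cong next eq)))
                   (u ≟ next e) (prev u ≟ e)

  ≢prev : 1 ≤ k → ∀ u → u ≢ prev u
  ≢prev (s≤s z≤n) 0F          eq = case trans (cong toℕ eq) (toℕ-fromℕ _) of λ ()
  ≢prev _         (Fin.suc i) eq = ℕ.1+n≢n (trans (cong toℕ eq) (toℕ-inject₁ i))

  ∑-at-ends : ∀ u (x y : Fin (suc k) → ℕ) →
              ∑ (suc k) (λ e → when ⌊ u ≟ e ⌋ (x e) + when ⌊ u ≟ next e ⌋ (y e)) ≡ x u + y (prev u)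
  ∑-at-ends u x y = begin
    ∑ (suc k) (λ e → when ⌊ u ≟ e ⌋ (x e) + when ⌊ u ≟ next e ⌋ (y e))
      ≡⟨ ∑-cong (suc k) (λ e → cong (λ b → when ⌊ u ≟ e ⌋ (x e) + when b (y e)) (≟next u e)) ⟩
    ∑ (suc k) (λ e → when ⌊ u ≟ e ⌋ (x e) + when ⌊ prev u ≟ e ⌋ (y e))
      ≡⟨ ∑-distrib-+ (suc k) (λ e → when ⌊ u ≟ e ⌋ (x e)) (λ e → when ⌊ prev u ≟ e ⌋ (y e)) ⟩
    ∑ (suc k) (λ e → when ⌊ u ≟ e ⌋ (x e)) + ∑ (suc k) (λ e → when ⌊ prev u ≟ e ⌋ (y e))
      ≡⟨ cong₂ _+_ (∑-δ (suc k) u x) (∑-δ (suc k) (prev u) y) ⟩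
    x u + y (prev u)
      ∎

  incidenceSum-cycle : 1 ≤ k → ∀ ℓ u → incidenceSum C ℓ u ≡ ℓ u + ℓ (prev u)
  incidenceSum-cycle 1≤k ℓ u = trans (∑-cong (suc k) split) (∑-at-ends u ℓ ℓ)
    where
    -- the two ends of an edge are distinct, so an incident edge is counted once
    split : ∀ e → when (incident C u e) (ℓ e) ≡ when ⌊ u ≟ e ⌋ (ℓ e) + when ⌊ u ≟ next e ⌋ (ℓ e)
    split e rewrite ≟next u e with u ≟ e | prev u ≟ e
    ... | yes u≡e | yes pu≡e = contradiction (trans u≡e (sym pu≡e)) (≢prev 1≤k u)
    ... | yes _   | no _     = sym (ℕ.+-identityʳ (ℓ e))
    ... | no _    | _        = refl

module Labelling (k l : ℕ) where

  open ≡-Reasoning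

  m n : ℕ
  m = suc k
  n = suc l

  open Corona (Cycle m) (Cycle n)

  -- The edge put in slot number i gets label 1 + i.  Within the block of the e-th copy, slot
  -- (f , 0F) holds its edge f and slot (f , 1F) the join edge from its vertex opposite f.
  Slot : Set
  Slot = Fin m ⊎ (Fin m × (Fin n × Fin 2) ⊎ Fin m × Fin n)

  slotLayout : Fin (m + (m * (n * 2) + m * n)) ↔ Slot
  slotLayout = ↔-trans +↔⊎ (↔-id _ ⊎-↔ ↔-trans +↔⊎ (↔-trans *↔× (↔-id _ ×-↔ *↔×) ⊎-↔ *↔×))

  toSlot : Edge → Slot
  toSlot (inj₁ e)                     = inj₁ e
  toSlot (inj₂ (inj₁ (e , f)))        = inj₂ (inj₁ (e , f , 0F))
  toSlot (inj₂ (inj₂ (e , v , 0F)))   = inj₂ (inj₂ (opposite e , opposite v))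
  toSlot (inj₂ (inj₂ (e , v , 1F)))   = inj₂ (inj₁ (e , opposite v , 1F))

  fromSlot : Slot → Edge
  fromSlot (inj₁ e)                   = inj₁ e
  fromSlot (inj₂ (inj₁ (e , f , 0F))) = inj₂ (inj₁ (e , f))
  fromSlot (inj₂ (inj₁ (e , f , 1F))) = inj₂ (inj₂ (e , opposite f , 1F))
  fromSlot (inj₂ (inj₂ (e , v)))      = inj₂ (inj₂ (opposite e , opposite v , 0F))

  toSlot-fromSlot : ∀ x → toSlot (fromSlot x) ≡ x
  toSlot-fromSlot (inj₁ e)                   = refl
  toSlot-fromSlot (inj₂ (inj₁ (e , f , 0F))) = refl
  toSlot-fromSlot (inj₂ (inj₁ (e , f , 1F))) = cong (λ f′ → inj₂ (inj₁ (e , f′ , 1F))) (opposite-involutive f)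
  toSlot-fromSlot (inj₂ (inj₂ (e , v)))      =
    cong₂ (λ e′ v′ → inj₂ (inj₂ (e′ , v′))) (opposite-involutive e) (opposite-involutive v)

  fromSlot-toSlot : ∀ x → fromSlot (toSlot x) ≡ x
  fromSlot-toSlot (inj₁ e)                   = refl
  fromSlot-toSlot (inj₂ (inj₁ (e , f)))      = refl
  fromSlot-toSlot (inj₂ (inj₂ (e , v , 0F))) =
    cong₂ (λ e′ v′ → inj₂ (inj₂ (e′ , v′ , 0F))) (opposite-involutive e) (opposite-involutive v)
  fromSlot-toSlot (inj₂ (inj₂ (e , v , 1F))) = cong (λ v′ → inj₂ (inj₂ (e , v′ , 1F))) (opposite-involutive v)

  σ : Permutation (E Γ) (E Γ)
  σ = ↔-trans edgeLayout (↔-trans (mk↔ₛ′ toSlot fromSlot toSlot-fromSlot fromSlot-toSlot)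
        (↔-trans (↔-sym slotLayout) (cast-id (cong (m +_) (ℕ.+-comm (m * (n * 2)) (m * n))))))

  label-edgeAt : ∀ x → label σ (edgeAt x) ≡ suc (toℕ (Inverse.from slotLayout (toSlot x)))
  label-edgeAt x = cong suc (trans (toℕ-cast _ _)
                                   (cong (toℕ ∘ Inverse.from slotLayout ∘ toSlot) (Inverse.strictlyInverseˡ edgeLayout x)))

  toℕ-slot-block : ∀ e f s → toℕ (Inverse.from slotLayout (inj₂ (inj₁ (e , f , s))))
                            ≡ m + (n * 2 * toℕ e + (2 * toℕ f + toℕ s))
  toℕ-slot-block e f s = begin
    toℕ (m ↑ʳ (combine e (combine f s) ↑ˡ m * n)) ≡⟨ toℕ-↑ʳ m _ ⟩
    m + toℕ (combine e (combine f s) ↑ˡ m * n)     ≡⟨ cong (m +_) (toℕ-↑ˡ _ (m * n)) ⟩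
    m + toℕ (combine e (combine f s))             ≡⟨ cong (m +_) (toℕ-combine e (combine f s)) ⟩
    m + (n * 2 * toℕ e + toℕ (combine f s))       ≡⟨ cong (λ z → m + (n * 2 * toℕ e + z)) (toℕ-combine f s) ⟩
    m + (n * 2 * toℕ e + (2 * toℕ f + toℕ s))     ∎

  label-baseEdge : ∀ e → label σ (baseEdge e) ≡ suc (toℕ e)
  label-baseEdge e = trans (label-edgeAt (inj₁ e)) (cong suc (toℕ-↑ˡ e _))

  label-copyEdge : ∀ e f → label σ (copyEdge e f) ≡ suc (m + (n * 2 * toℕ e + 2 * toℕ f))
  label-copyEdge e f = trans (label-edgeAt (inj₂ (inj₁ (e , f))))
    (cong suc (trans (toℕ-slot-block e f 0F) (cong (λ z → m + (n * 2 * toℕ e + z)) (ℕ.+-identityʳ (2 * toℕ f)))))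

  label-joinEdge₁ : ∀ e v → label σ (joinEdge e v 1F) ≡ suc (m + (n * 2 * toℕ e + (2 * toℕ (opposite v) + 1)))
  label-joinEdge₁ e v = trans (label-edgeAt (inj₂ (inj₂ (e , v , 1F)))) (cong suc (toℕ-slot-block e (opposite v) 1F))

  label-joinEdge₀ : ∀ e v → label σ (joinEdge e v 0F)
                          ≡ suc (m + (m * (n * 2) + (n * toℕ (opposite e) + toℕ (opposite v))))
  label-joinEdge₀ e v = trans (label-edgeAt (inj₂ (inj₂ (e , v , 0F)))) (cong suc (begin
    toℕ (m ↑ʳ (m * (n * 2) ↑ʳ combine (opposite e) (opposite v)))  ≡⟨ toℕ-↑ʳ m _ ⟩
    m + toℕ (m * (n * 2) ↑ʳ combine (opposite e) (opposite v))      ≡⟨ cong (m +_) (toℕ-↑ʳ (m * (n * 2)) _) ⟩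
    m + (m * (n * 2) + toℕ (combine (opposite e) (opposite v)))
      ≡⟨ cong (λ z → m + (m * (n * 2) + z)) (toℕ-combine (opposite e) (opposite v)) ⟩
    m + (m * (n * 2) + (n * toℕ (opposite e) + toℕ (opposite v)))   ∎))

  module CG = CycleFacts k
  module CH = CycleFacts l

  copyResidue : Fin n → ℕ
  copyResidue v = 2 * toℕ v + 2 * toℕ (CH.prev v) + 3 * toℕ (opposite v)

  copyBase : ℕ
  copyBase = 5 + 4 * m + m * (n * 2) + n * k

  weight-copy : 1 ≤ l → ∀ e v → weight Γ σ (copy e v) ≡ copyBase + (copyResidue v + toℕ e * (5 * n))
  weight-copy 1≤l e v = begin
    weight Γ σ (copy e v)
      ≡⟨ weight≡incidenceSum Γ σ (copy e v) ⟩
    incidenceSum Γ (label σ) (copy e v)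
      ≡⟨ incidenceSum-copy (label σ) e v ⟩
    incidenceSum (Cycle n) (label σ ∘ copyEdge e) v + (label σ (joinEdge e v 0F) + label σ (joinEdge e v 1F))
      ≡⟨ cong (_+ (label σ (joinEdge e v 0F) + label σ (joinEdge e v 1F)))
              (CH.incidenceSum-cycle 1≤l (label σ ∘ copyEdge e) v) ⟩
    label σ (copyEdge e v) + label σ (copyEdge e (CH.prev v)) + (label σ (joinEdge e v 0F) + label σ (joinEdge e v 1F))
      ≡⟨ cong₂ _+_ (cong₂ _+_ (label-copyEdge e v) (label-copyEdge e (CH.prev v)))
                   (cong₂ _+_ (label-joinEdge₀ e v) (label-joinEdge₁ e v)) ⟩
    _ ≡⟨ expand m n (toℕ e) (toℕ (opposite e)) (toℕ v) (toℕ (CH.prev v)) (toℕ (opposite v)) ⟩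
    5 + 4 * m + m * (n * 2) + n * (toℕ e + toℕ (opposite e)) + (copyResidue v + toℕ e * (5 * n))
      ≡⟨ cong (λ z → 5 + 4 * m + m * (n * 2) + n * z + (copyResidue v + toℕ e * (5 * n))) (toℕ+toℕ-opposite e) ⟩
    5 + 4 * m + m * (n * 2) + n * k + (copyResidue v + toℕ e * (5 * n))
      ∎
    where
    -- solve-∀ does not unfold definitions such as m, n or copyResidue, hence the fresh variables.
    expand : ∀ m n e ē v p v̄ →
      suc (m + (n * 2 * e + 2 * v)) + suc (m + (n * 2 * e + 2 * p))
        + (suc (m + (m * (n * 2) + (n * ē + v̄))) + suc (m + (n * 2 * e + (2 * v̄ + 1))))
      ≡ 5 + 4 * m + m * (n * 2) + n * (e + ē) + ((2 * v + 2 * p + 3 * v̄) + e * (5 * n))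
    expand = solve-∀

  hubResidue : Fin m → ℕ
  hubResidue u = toℕ u + toℕ (CG.prev u) + n * n * toℕ (opposite u) + 2 * (n * n) * toℕ (CG.prev u)

  V̄ : ℕ
  V̄ = ∑ n (toℕ ∘ opposite)

  hubBase : ℕ
  hubBase = 2 + n * (1 + m + m * (n * 2)) + n * (2 + m) + 3 * V̄

  weight-base : 1 ≤ k → ∀ u → weight Γ σ (base u) ≡ hubBase + hubResidue u
  weight-base 1≤k u = begin
    weight Γ σ (base u)
      ≡⟨ weight≡incidenceSum Γ σ (base u) ⟩
    incidenceSum Γ (label σ) (base u)
      ≡⟨ incidenceSum-base (label σ) u ⟩
    incidenceSum (Cycle m) (label σ ∘ baseEdge) u
      + ∑ m (λ e → when ⌊ u ≟ e ⌋ (joins₀ e) + when ⌊ u ≟ CG.next e ⌋ (joins₁ e))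
      ≡⟨ cong₂ _+_ (CG.incidenceSum-cycle 1≤k (label σ ∘ baseEdge) u) (CG.∑-at-ends u joins₀ joins₁) ⟩
    label σ (baseEdge u) + label σ (baseEdge (CG.prev u)) + (joins₀ u + joins₁ (CG.prev u))
      ≡⟨ cong₂ _+_ (cong₂ _+_ (label-baseEdge u) (label-baseEdge (CG.prev u)))
                   (cong₂ _+_ (joins₀≡ u) (joins₁≡ (CG.prev u))) ⟩
    _ ≡⟨ expand m n (toℕ u) (toℕ (CG.prev u)) (toℕ (opposite u)) V̄ ⟩
    2 + n * (1 + m + m * (n * 2)) + n * (2 + m) + 3 * V̄ + hubResidue u
      ∎
    where
    joins₀ joins₁ : Fin m → ℕ
    joins₀ e = ∑ n (λ v → label σ (joinEdge e v 0F))
    joins₁ e = ∑ n (λ v → label σ (joinEdge e v 1F))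

    joins₀≡ : ∀ e → joins₀ e ≡ n * suc (m + (m * (n * 2) + n * toℕ (opposite e))) + 1 * V̄
    joins₀≡ e = trans (∑-cong n (λ v → trans (label-joinEdge₀ e v) (shift m n (toℕ (opposite e)) (toℕ (opposite v)))))
                      (∑-affine n (suc (m + (m * (n * 2) + n * toℕ (opposite e)))) 1 (toℕ ∘ opposite))
      where
      shift : ∀ m n ē v̄ → suc (m + (m * (n * 2) + (n * ē + v̄))) ≡ suc (m + (m * (n * 2) + n * ē)) + 1 * v̄
      shift = solve-∀

    joins₁≡ : ∀ e → joins₁ e ≡ n * suc (m + (n * 2 * toℕ e + 1)) + 2 * V̄
    joins₁≡ e = trans (∑-cong n (λ v → trans (label-joinEdge₁ e v) (shift m n (toℕ e) (toℕ (opposite v)))))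
                      (∑-affine n (suc (m + (n * 2 * toℕ e + 1))) 2 (toℕ ∘ opposite))
      where
      shift : ∀ m n e v̄ → suc (m + (n * 2 * e + (2 * v̄ + 1))) ≡ suc (m + (n * 2 * e + 1)) + 2 * v̄
      shift = solve-∀

    expand : ∀ m n x p x̄ V̄ →
      suc x + suc p + (n * suc (m + (m * (n * 2) + n * x̄)) + 1 * V̄ + (n * suc (m + (n * 2 * p + 1)) + 2 * V̄))
      ≡ 2 + n * (1 + m + m * (n * 2)) + n * (2 + m) + 3 * V̄ + (x + p + n * n * x̄ + 2 * (n * n) * p)
    expand = solve-∀

module CoronaOfCycles (a b : ℕ) where

  open Labelling (2 + a) (2 + b)
  open Corona (Cycle m) (Cycle n)

  copyResidue-zero : copyResidue 0F ≡ 5 * (2 + b)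
  copyResidue-zero = begin
    2 * 0 + 2 * toℕ (fromℕ (2 + b)) + 3 * toℕ (opposite (Fin.zero {2 + b}))
      ≡⟨ cong₂ (λ p v̄ → 2 * 0 + 2 * p + 3 * v̄) (toℕ-fromℕ (2 + b)) (toℕ+toℕ-opposite (Fin.zero {2 + b})) ⟩
    2 * 0 + 2 * (2 + b) + 3 * (2 + b)
      ≡⟨ collect b ⟩
    5 * (2 + b) ∎
    where
    open ≡-Reasoning
    collect : ∀ b → 2 * 0 + 2 * (2 + b) + 3 * (2 + b) ≡ 5 * (2 + b)
    collect = solve-∀

  copyResidue-suc : ∀ t → copyResidue (Fin.suc t) ≡ 5 + 3 * b + toℕ t
  copyResidue-suc t = begin
    2 * suc (toℕ t) + 2 * toℕ (inject₁ t) + 3 * toℕ (opposite (Fin.suc t))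
      ≡⟨ cong (λ p → 2 * suc (toℕ t) + 2 * p + 3 * toℕ (opposite (Fin.suc t))) (toℕ-inject₁ t) ⟩
    2 * suc (toℕ t) + 2 * toℕ t + 3 * toℕ (opposite (Fin.suc t))
      ≡⟨ regroup (toℕ t) (toℕ (opposite (Fin.suc t))) ⟩
    2 + toℕ t + 3 * (toℕ t + toℕ (opposite (Fin.suc t)))
      ≡⟨ cong (λ z → 2 + toℕ t + 3 * z) (ℕ.suc-injective (toℕ+toℕ-opposite (Fin.suc t))) ⟩
    2 + toℕ t + 3 * (1 + b)
      ≡⟨ regroup′ (toℕ t) b ⟩
    5 + 3 * b + toℕ t ∎
    where
    open ≡-Reasoning
    regroup : ∀ t v̄ → 2 * suc t + 2 * t + 3 * v̄ ≡ 2 + t + 3 * (t + v̄)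
    regroup = solve-∀
    regroup′ : ∀ t b → 2 + t + 3 * (1 + b) ≡ 5 + 3 * b + t
    regroup′ = solve-∀

  copyResidue-suc<zero : ∀ t → copyResidue (Fin.suc t) < copyResidue 0F
  copyResidue-suc<zero t = begin-strict
    copyResidue (Fin.suc t)       ≡⟨ copyResidue-suc t ⟩
    5 + 3 * b + toℕ t             <⟨ ℕ.+-monoʳ-< (5 + 3 * b) (toℕ<n t) ⟩
    5 + 3 * b + (2 + b)           ≤⟨ ℕ.m≤m+n _ (3 + b) ⟩
    5 + 3 * b + (2 + b) + (3 + b) ≡⟨ collect b ⟩
    5 * (2 + b)                   ≡⟨ copyResidue-zero ⟨
    copyResidue 0F                ∎
    where
    open ℕ.≤-Reasoning
    collect : ∀ b → 5 + 3 * b + (2 + b) + (3 + b) ≡ 5 * (2 + b)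
    collect = solve-∀

  copyResidue<5n : ∀ v → copyResidue v < 5 * n
  copyResidue<5n v = ℕ.≤-<-trans (atMostZero v)
    (subst (_< 5 * n) (sym copyResidue-zero) (ℕ.*-monoʳ-< 5 (ℕ.n<1+n (2 + b))))
    where
    atMostZero : ∀ v → copyResidue v ≤ copyResidue 0F
    atMostZero 0F          = ℕ.≤-refl
    atMostZero (Fin.suc t) = ℕ.<⇒≤ (copyResidue-suc<zero t)

  copyResidue-injective : Injective _≡_ _≡_ copyResidue
  copyResidue-injective = maximum-at-0F⇒injective copyResidue copyResidue-suc<zero λ {t} {t′} eq →
    toℕ-injective (ℕ.+-cancelˡ-≡ (5 + 3 * b) _ _ (trans (sym (copyResidue-suc t)) (trans eq (copyResidue-suc t′))))

  hubResidue-zero : hubResidue 0F ≡ (2 + a) * (1 + 3 * (n * n))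
  hubResidue-zero = begin
    0 + toℕ (fromℕ (2 + a)) + n * n * toℕ (opposite (Fin.zero {2 + a})) + 2 * (n * n) * toℕ (fromℕ (2 + a))
      ≡⟨ cong₂ (λ p x̄ → 0 + p + n * n * x̄ + 2 * (n * n) * p)
               (toℕ-fromℕ (2 + a)) (toℕ+toℕ-opposite (Fin.zero {2 + a})) ⟩
    0 + (2 + a) + n * n * (2 + a) + 2 * (n * n) * (2 + a)
      ≡⟨ collect n a ⟩
    (2 + a) * (1 + 3 * (n * n)) ∎
    where
    open ≡-Reasoning
    collect : ∀ n a → 0 + (2 + a) + n * n * (2 + a) + 2 * (n * n) * (2 + a) ≡ (2 + a) * (1 + 3 * (n * n))
    collect = solve-∀

  hubResidue-suc : ∀ t → hubResidue (Fin.suc t) ≡ 1 + n * n * (1 + a) + (2 + n * n) * toℕ t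
  hubResidue-suc t = begin
    suc (toℕ t) + toℕ (inject₁ t) + n * n * x̄ + 2 * (n * n) * toℕ (inject₁ t)
      ≡⟨ cong (λ p → suc (toℕ t) + p + n * n * x̄ + 2 * (n * n) * p) (toℕ-inject₁ t) ⟩
    suc (toℕ t) + toℕ t + n * n * x̄ + 2 * (n * n) * toℕ t
      ≡⟨ regroup n (toℕ t) x̄ ⟩
    1 + n * n * (toℕ t + x̄) + (2 + n * n) * toℕ t
      ≡⟨ cong (λ z → 1 + n * n * z + (2 + n * n) * toℕ t) (ℕ.suc-injective (toℕ+toℕ-opposite (Fin.suc t))) ⟩
    1 + n * n * (1 + a) + (2 + n * n) * toℕ t ∎
    where
    open ≡-Reasoning
    x̄ : ℕ
    x̄ = toℕ (opposite (Fin.suc t))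
    regroup : ∀ n t x̄ → suc t + t + n * n * x̄ + 2 * (n * n) * t ≡ 1 + n * n * (t + x̄) + (2 + n * n) * t
    regroup = solve-∀

  hubResidue-suc<zero : ∀ t → hubResidue (Fin.suc t) < hubResidue 0F
  hubResidue-suc<zero t = begin-strict
    hubResidue (Fin.suc t)
      ≡⟨ hubResidue-suc t ⟩
    1 + n * n * (1 + a) + (2 + n * n) * toℕ t
      ≤⟨ ℕ.+-monoʳ-≤ (1 + n * n * (1 + a)) (ℕ.*-monoʳ-≤ (2 + n * n) (s≤s⁻¹ (toℕ<n t))) ⟩
    1 + n * n * (1 + a) + (2 + n * n) * (1 + a)
      <⟨ ℕ.m<m+n _ (s≤s z≤n) ⟩
    1 + n * n * (1 + a) + (2 + n * n) * (1 + a) + (35 + 24 * b + 4 * b * b + 8 * a + 6 * a * b + a * b * b)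
      ≡⟨ collect a b ⟩
    (2 + a) * (1 + 3 * (n * n))
      ≡⟨ hubResidue-zero ⟨
    hubResidue 0F ∎
    where
    open ℕ.≤-Reasoning
    collect : ∀ a b → 1 + (3 + b) * (3 + b) * (1 + a) + (2 + (3 + b) * (3 + b)) * (1 + a)
                        + (35 + 24 * b + 4 * b * b + 8 * a + 6 * a * b + a * b * b)
                      ≡ (2 + a) * (1 + 3 * ((3 + b) * (3 + b)))
    collect = solve-∀

  hubResidue-injective : Injective _≡_ _≡_ hubResidue
  hubResidue-injective = maximum-at-0F⇒injective hubResidue hubResidue-suc<zero λ {t} {t′} eq →
    toℕ-injective (ℕ.*-cancelˡ-≡ _ _ (2 + n * n)
      (ℕ.+-cancelˡ-≡ (1 + n * n * (1 + a)) _ _ (trans (sym (hubResidue-suc t)) (trans eq (hubResidue-suc t′)))))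

  hubResidue-lower : ∀ u → 1 + n * n * (1 + a) ≤ hubResidue u
  hubResidue-lower 0F          = ℕ.≤-trans (hubResidue-lower (Fin.suc 0F)) (ℕ.<⇒≤ (hubResidue-suc<zero 0F))
  hubResidue-lower (Fin.suc t) =
    subst (1 + n * n * (1 + a) ≤_) (sym (hubResidue-suc t)) (ℕ.m≤m+n _ ((2 + n * n) * toℕ t))

  weight-copy<weight-base : ∀ e v u → weight Γ σ (copy e v) < weight Γ σ (base u)
  weight-copy<weight-base e v u = begin-strict
    weight Γ σ (copy e v)
      ≡⟨ weight-copy (s≤s z≤n) e v ⟩
    copyBase + (copyResidue v + toℕ e * (5 * n))
      <⟨ ℕ.+-monoʳ-< copyBase (ℕ.+-mono-<-≤ (copyResidue<5n v) (ℕ.*-monoˡ-≤ (5 * n) (s≤s⁻¹ (toℕ<n e)))) ⟩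
    copyBase + (5 * n + (2 + a) * (5 * n))
      ≤⟨ ℕ.m≤m+n _ (7 + 28 * b + 7 * b * b + 5 * a + 12 * a * b + 3 * a * b * b) ⟩
    copyBase + (5 * n + (2 + a) * (5 * n)) + (7 + 28 * b + 7 * b * b + 5 * a + 12 * a * b + 3 * a * b * b)
      ≡⟨ collect a b ⟩
    h + (1 + n * n * (1 + a))
      ≤⟨ ℕ.+-mono-≤ (ℕ.m≤m+n h (3 * V̄)) (hubResidue-lower u) ⟩
    hubBase + hubResidue u
      ≡⟨ weight-base (s≤s z≤n) u ⟨
    weight Γ σ (base u) ∎
    where
    open ℕ.≤-Reasoning
    h : ℕ
    h = 2 + n * (1 + m + m * (n * 2)) + n * (2 + m)
    collect : ∀ a b →
      5 + 4 * (3 + a) + (3 + a) * ((3 + b) * 2) + (3 + b) * (2 + a) + (5 * (3 + b) + (2 + a) * (5 * (3 + b)))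
        + (7 + 28 * b + 7 * b * b + 5 * a + 12 * a * b + 3 * a * b * b)
      ≡ 2 + (3 + b) * (1 + (3 + a) + (3 + a) * ((3 + b) * 2)) + (3 + b) * (2 + (3 + a)) + (1 + (3 + b) * (3 + b) * (1 + a))
    collect = solve-∀

  weight-injective : Injective _≡_ _≡_ (weight Γ σ)
  weight-injective = injective-via-↔ vertexLayout λ {p} {q} → onLayout p q
    where
    onLayout : ∀ p q → weight Γ σ (vertexAt p) ≡ weight Γ σ (vertexAt q) → p ≡ q
    onLayout (inj₁ u) (inj₁ u′) eq = cong inj₁ (hubResidue-injective (ℕ.+-cancelˡ-≡ hubBase _ _
      (trans (sym (weight-base (s≤s z≤n) u)) (trans eq (weight-base (s≤s z≤n) u′)))))
    onLayout (inj₁ u) (inj₂ (e , v)) eq = contradiction (sym eq) (ℕ.<⇒≢ (weight-copy<weight-base e v u))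
    onLayout (inj₂ (e , v)) (inj₁ u) eq = contradiction eq (ℕ.<⇒≢ (weight-copy<weight-base e v u))
    onLayout (inj₂ (e , v)) (inj₂ (e′ , v′)) eq
      with remQuot-unique (copyResidue<5n v) (copyResidue<5n v′) (ℕ.+-cancelˡ-≡ copyBase _ _
             (trans (sym (weight-copy (s≤s z≤n) e v)) (trans eq (weight-copy (s≤s z≤n) e′ v′))))
    ... | r≡r′ , e≡e′ = cong₂ (λ e v → inj₂ (e , v)) (toℕ-injective e≡e′) (copyResidue-injective r≡r′)

  antimagic : Antimagic (Cycle (3 + a) ◇ Cycle (3 + b))
  antimagic = σ , weight-injective

theorem3p3 : (m n : ℕ) → 3 ≤ m → 3 ≤ n → Antimagic (Cycle m ◇ Cycle n)
theorem3p3 (suc (suc (suc a))) (suc (suc (suc b))) (s≤s (s≤s (s≤s _))) (s≤s (s≤s (s≤s _))) =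
  CoronaOfCycles.antimagic a b
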